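{- Let $R$ be a right semihereditary ring. Then (1) $\mathfrak{s}(\mathfrak{s}(M))=\mathfrak{s}(M)$ for every left $R$-module $M$, and (2) $\mathfrak{s}(M)$ is $\mathfrak{s}$-torsion for every left $R$-module $M$.
   Context: A pp-formula is an existentially quantified finite system of $R$-linear equations. A pp-formula $\psi(x)$ in one free variable is low if $\psi[{}_RR]=0$. For a left module $M$, $\mathfrak{s}(M)=\{m\in M: M\models\psi[m]$ for some low $\psi\}$ (a submodule). $M$ is $\mathfrak{s}$-torsion if $\mathfrak{s}(M)=M$. $R$ is right semihereditary if finitely generated submodules of projective right $R$-modules are projective. -}

module Defs where

open import Level using (Level; _⊔_; Setω)
open import Algebra.Bundles using (Ring)
open import Algebra.Module.Bundles using (LeftModule; RightModule; RawRightModule)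
open import Algebra.Module.Morphism.Structures using (module RightModuleMorphisms)
import Algebra.Module.Morphism.RightModuleMonomorphism as RMM
open import Algebra.Module.Construct.TensorUnit using (leftModule)
open import Data.Nat using (ℕ; zero; suc)
open import Data.Fin using (Fin; zero; suc)
open import Data.Product using (Σ; _×_; _,_; proj₁; proj₂; ∃)
open import Function.Definitions using (Surjective)

private
  variable
    r ℓr m ℓm : Level

module _ {R : Ring r ℓr} (M : LeftModule R m ℓm) where
  open LeftModule M

  sumₗ : (k : ℕ) → (Fin k → Carrierᴹ) → Carrierᴹ
  sumₗ zero    f = 0ᴹ
  sumₗ (suc k) f = f zero +ᴹ sumₗ k (λ j → f (suc j))

module _ {R : Ring r ℓr} (M : RightModule R m ℓm) where
  open RightModule M

  sumᵣ : (k : ℕ) → (Fin k → Carrierᴹ) → Carrierᴹ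
  sumᵣ zero    f = 0ᴹ
  sumᵣ (suc k) f = f zero +ᴹ sumᵣ k (λ j → f (suc j))

-- pp-formulas in one free variable x (language of left R-modules):
--   ψ(x) = ∃ y₀ … y_{k-1}.  ⋀_{i < n}  a_i x + Σ_j b_{ij} y_j = 0

record PPFormula (R : Ring r ℓr) : Set r where
  open Ring R
  field
    eqs    : ℕ
    vars   : ℕ
    coeffX : Fin eqs → Carrier
    coeffY : Fin eqs → Fin vars → Carrier

module _ {R : Ring r ℓr} (M : LeftModule R m ℓm) (ψ : PPFormula R) where
  open LeftModule M
  open PPFormula ψ

  Holds : Carrierᴹ → (Fin vars → Carrierᴹ) → Set ℓm
  Holds x y = (i : Fin eqs) →
    (coeffX i *ₗ x) +ᴹ sumₗ M vars (λ j → coeffY i j *ₗ y j) ≈ᴹ 0ᴹ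

  Sat : Carrierᴹ → Set (m ⊔ ℓm)
  Sat x = Σ (Fin vars → Carrierᴹ) λ y → Holds x y

  -- N ⊨ ψ[x] where N ⊆ M is the substructure (submodule) given by the
  -- subset P : witnesses must be taken inside N; operations are those of M.
  SatIn : ∀ {p} → (Carrierᴹ → Set p) → Carrierᴹ → Set (m ⊔ ℓm ⊔ p)
  SatIn P x = Σ (Fin vars → Carrierᴹ) λ y → ((j : Fin vars) → P (y j)) × Holds x y

Low : {R : Ring r ℓr} → PPFormula R → Set (r ⊔ ℓr)
Low {R = R} ψ = (a : Carrier) → Sat (leftModule {R = R}) ψ a → a ≈ 0#
  where open Ring R

𝔰 : {R : Ring r ℓr} (M : LeftModule R m ℓm) → LeftModule.Carrierᴹ M → Set (r ⊔ ℓr ⊔ m ⊔ ℓm)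
𝔰 {R = R} M x = Σ (PPFormula R) λ ψ → Low ψ × Sat M ψ x

-- 𝔰(N) as a subset of M, for the submodule N ⊆ M with underlying subset P
𝔰In : {R : Ring r ℓr} (M : LeftModule R m ℓm) {p : Level} →
      (LeftModule.Carrierᴹ M → Set p) → LeftModule.Carrierᴹ M → Set (r ⊔ ℓr ⊔ m ⊔ ℓm ⊔ p)
𝔰In {R = R} M P x = P x × Σ (PPFormula R) λ ψ → Low ψ × SatIn M ψ P x

𝔰-TorsionIn : {R : Ring r ℓr} (M : LeftModule R m ℓm) {p : Level} →
              (LeftModule.Carrierᴹ M → Set p) → Set (r ⊔ ℓr ⊔ m ⊔ ℓm ⊔ p)
𝔰-TorsionIn M P = ∀ x → P x → 𝔰In M P x

IsHom : {R : Ring r ℓr} {a ℓa b ℓb : Level} (A : RightModule R a ℓa) (B : RightModule R b ℓb) →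
        (RightModule.Carrierᴹ A → RightModule.Carrierᴹ B) → Set (r ⊔ a ⊔ ℓa ⊔ ℓb)
IsHom A B = RightModuleMorphisms.IsRightModuleHomomorphism
              (RightModule.rawRightModule A) (RightModule.rawRightModule B)

Projective : {R : Ring r ℓr} → RightModule R m ℓm → Setω
Projective {R = R} Q =
  ∀ {a ℓa b ℓb} (A : RightModule R a ℓa) (B : RightModule R b ℓb)
  (g : RightModule.Carrierᴹ A → RightModule.Carrierᴹ B) → IsHom A B g →
  Surjective (RightModule._≈ᴹ_ A) (RightModule._≈ᴹ_ B) g →
  (f : RightModule.Carrierᴹ Q → RightModule.Carrierᴹ B) → IsHom Q B f →
  Σ (RightModule.Carrierᴹ Q → RightModule.Carrierᴹ A) λ h →
    IsHom Q A h × (∀ x → RightModule._≈ᴹ_ B (g (h x)) (f x))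

record Submodule {R : Ring r ℓr} (P : RightModule R m ℓm) (p : Level) : Set (r ⊔ m ⊔ ℓm ⊔ Level.suc p) where
  open RightModule P
  field
    mem     : Carrierᴹ → Set p
    mem-resp : ∀ {x y} → x ≈ᴹ y → mem x → mem y
    mem-0   : mem 0ᴹ
    mem-+   : ∀ {x y} → mem x → mem y → mem (x +ᴹ y)
    mem--   : ∀ {x} → mem x → mem (-ᴹ x)
    mem-*   : ∀ {x} (c : Ring.Carrier R) → mem x → mem (x *ᵣ c)

module _ {R : Ring r ℓr} {P : RightModule R m ℓm} {p : Level} (S : Submodule P p) where
  open RightModule P
  open Submodule S

  private
    C : Set (m ⊔ p)
    C = Σ Carrierᴹ mem

    rawS : RawRightModule (Ring.Carrier R) (m ⊔ p) ℓm
    rawS = record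
      { Carrierᴹ = C
      ; _≈ᴹ_ = λ u v → proj₁ u ≈ᴹ proj₁ v
      ; _+ᴹ_ = λ u v → (proj₁ u +ᴹ proj₁ v) , mem-+ (proj₂ u) (proj₂ v)
      ; _*ᵣ_ = λ u c → (proj₁ u *ᵣ c) , mem-* c (proj₂ u)
      ; 0ᴹ = 0ᴹ , mem-0
      ; -ᴹ_ = λ u → (-ᴹ proj₁ u) , mem-- (proj₂ u)
      }

    incl-mono : RightModuleMorphisms.IsRightModuleMonomorphism rawS rawRightModule proj₁
    incl-mono = record
      { isRightModuleHomomorphism = record
        { +ᴹ-isGroupHomomorphism = record
          { isMonoidHomomorphism = record
            { isMagmaHomomorphism = record
              { isRelHomomorphism = record { cong = λ e → e }
              ; homo = λ _ _ → ≈ᴹ-refl }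
            ; ε-homo = ≈ᴹ-refl }
          ; ⁻¹-homo = λ _ → ≈ᴹ-refl }
        ; *ᵣ-homo = λ _ _ → ≈ᴹ-refl }
      ; injective = λ e → e
      }

  toRightModule : RightModule R (m ⊔ p) ℓm
  toRightModule = record
    { isRightModule = RMM.isRightModule incl-mono (Ring.isRing R) isRightModule }

  FinitelyGenerated : Set (r ⊔ m ⊔ ℓm ⊔ p)
  FinitelyGenerated =
    Σ ℕ λ n → Σ (Fin n → Carrierᴹ) λ g → ((i : Fin n) → mem (g i)) ×
      (∀ x → mem x → Σ (Fin n → Ring.Carrier R) λ c → x ≈ᴹ sumᵣ P n (λ i → g i *ᵣ c i))

RightSemihereditary : Ring r ℓr → Setω
RightSemihereditary R =
  ∀ {m ℓm p} (P : RightModule R m ℓm) → Projective P →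
  (S : Submodule P p) → FinitelyGenerated S → Projective (toRightModule S)

-- Let x ∈ 𝔰(M) via a low formula ψ, i.e. A · (x , y) = 0 for the coefficient matrix A of ψ.
-- Over a right semihereditary ring the image of A : Rᵏ → Rⁿ is a finitely generated submodule of
-- a free module, hence projective, so A splits onto its image and the kernel of A is cut out by an
-- idempotent matrix E with A E = 0 which fixes every solution of A.  Lowness of ψ says that every
-- solution of A in R has first coordinate 0, so the first row of E vanishes.  Replacing the witness
-- u = (x , y) by v = u - E u gives a common solution of A and E with v₀ = x.  In R the only common
-- solution is 0, so each formula "z is the t-th coordinate of a solution of (A ; E)" is low; these
-- formulas put every vₜ into 𝔰(M) and show that x satisfies a low formula with witnesses in 𝔰(M).

module Submission where

open import Defs
open import Level using (_⊔_)
open import Algebra.Bundles using (Ring; Monoid; AbelianGroup)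
open import Algebra.Module.Bundles using (LeftModule; RightModule)
open import Algebra.Module.Morphism.Structures using (module RightModuleMorphisms)
open import Algebra.Morphism.Structures using (module MonoidMorphisms)
import Algebra.Properties.Monoid.Sum as MonoidSum
import Algebra.Properties.AbelianGroup as AbelianGroupProperties
import Algebra.Module.Morphism.Construct.Composition as Comp
import Algebra.Module.Morphism.Construct.Identity as Id
open import Data.Nat as ℕ using (ℕ; zero; suc)
open import Data.Fin using (Fin; zero; suc; splitAt; _↑ˡ_; _↑ʳ_)
open import Data.Sum using (inj₁; inj₂)
open import Data.Vec.Functional.Properties using (lookup-++ˡ; lookup-++ʳ)
open import Data.Vec.Functional using (Vector; map; tail; replicate; zipWith; _∷_; _++_)
open import Data.Product using (Σ; _×_; _,_; proj₁; proj₂)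
open import Function.Definitions using (Surjective)
open import Relation.Binary.PropositionalEquality as ≡ using (_≡_)

module _ {a ℓa b ℓb} (A : Monoid a ℓa) (B : Monoid b ℓb) where
  private
    module A = Monoid A
    module B = Monoid B
    module ΣA = MonoidSum A
    module ΣB = MonoidSum B
  open MonoidMorphisms A.rawMonoid B.rawMonoid

  sum-homo : ∀ {φ} → IsMonoidHomomorphism φ →
             ∀ {n} (f : Vector A.Carrier n) → φ (ΣA.sum f) B.≈ ΣB.sum (map φ f)
  sum-homo φ-homo {zero}  f = IsMonoidHomomorphism.ε-homo φ-homo
  sum-homo φ-homo {suc n} f =
    B.trans (IsMonoidHomomorphism.homo φ-homo _ _) (B.∙-congˡ (sum-homo φ-homo (tail f)))

module AbelianGroupSum {c ℓ} (G : AbelianGroup c ℓ) where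
  open AbelianGroup G
  open import Algebra.Properties.CommutativeMonoid.Sum commutativeMonoid public
  open MonoidMorphisms rawMonoid rawMonoid

  sum-zero : ∀ {n} (f : Vector Carrier n) → (∀ i → f i ≈ ε) → sum f ≈ ε
  sum-zero {n} f f≈ε = trans (sum-cong-≋ f≈ε) (sum-replicate-zero n)

  ⁻¹-isMonoidHomomorphism : IsMonoidHomomorphism _⁻¹
  ⁻¹-isMonoidHomomorphism = record
    { isMagmaHomomorphism = record
      { isRelHomomorphism = record { cong = ⁻¹-cong }
      ; homo = λ x y → sym (AbelianGroupProperties.⁻¹-∙-comm G x y) }
    ; ε-homo = ε⁻¹≈ε }
    where open import Algebra.Properties.Group group using (ε⁻¹≈ε)

  sum-⁻¹ : ∀ {n} (f : Vector Carrier n) → sum (map _⁻¹ f) ≈ sum f ⁻¹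
  sum-⁻¹ f = sym (sum-homo monoid monoid ⁻¹-isMonoidHomomorphism f)

  ∑-distrib-∙⁻¹ : ∀ {n} (f g : Vector Carrier n) →
                  ∑[ i < n ] (f i ∙ g i ⁻¹) ≈ ∑[ i < n ] f i ∙ (∑[ i < n ] g i) ⁻¹
  ∑-distrib-∙⁻¹ f g = trans (∑-distrib-+ f (map _⁻¹ g)) (∙-congˡ (sum-⁻¹ g))

module LinearAlgebra {r ℓr} (R : Ring r ℓr) where
  open Ring R hiding (zero)
  open import Algebra.Module.Construct.TensorUnit using (leftModule; rightModule)
  module ΣR = AbelianGroupSum +-abelianGroup

  Matrix : ℕ → ℕ → Set r
  Matrix n k = Fin n → Fin k → Carrier

  δ : ∀ {n} → Matrix n n
  δ zero    zero    = 1#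
  δ zero    (suc _) = 0#
  δ (suc _) zero    = 0#
  δ (suc i) (suc j) = δ i j

  infixl 7 _⊗_
  _⊗_ : ∀ {n k l} → Matrix n k → Matrix k l → Matrix n l
  (A ⊗ B) i l = ΣR.sum (λ j → A i j * B j l)

  module LeftAction {m ℓm} (M : LeftModule R m ℓm) where
    open LeftModule M
    open AbelianGroupSum +ᴹ-abelianGroup
    open import Algebra.Module.Properties.LeftModule M using (inverseˡ-uniqueᴹ)
    open import Relation.Binary.Reasoning.Setoid ≈ᴹ-setoid

    infixr 7 _·_
    _·_ : ∀ {n k} → Matrix n k → Vector Carrierᴹ k → Vector Carrierᴹ n
    (A · u) i = sum (λ j → A i j *ₗ u j)

    Solution : ∀ {n k} → Matrix n k → Vector Carrierᴹ k → Set ℓm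
    Solution A u = ∀ i → (A · u) i ≈ᴹ 0ᴹ

    ·-congˡ : ∀ {n k} {A B : Matrix n k} → (∀ i j → A i j ≈ B i j) → ∀ u i → (A · u) i ≈ᴹ (B · u) i
    ·-congˡ A≈B u i = sum-cong-≋ (λ j → *ₗ-congʳ (A≈B i j))

    *ₗ-distribˡ-sum : ∀ {n} c (u : Vector Carrierᴹ n) → c *ₗ sum u ≈ᴹ ∑[ j < n ] (c *ₗ u j)
    *ₗ-distribˡ-sum c = sum-homo +ᴹ-monoid +ᴹ-monoid record
      { isMagmaHomomorphism = record
        { isRelHomomorphism = record { cong = *ₗ-congˡ }
        ; homo = *ₗ-distribˡ c }
      ; ε-homo = *ₗ-zeroʳ c }

    *ₗ-distribʳ-sum : ∀ {n} (a : Vector Carrier n) u → ΣR.sum a *ₗ u ≈ᴹ ∑[ j < n ] (a j *ₗ u)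
    *ₗ-distribʳ-sum a u = sum-homo +-monoid +ᴹ-monoid record
      { isMagmaHomomorphism = record
        { isRelHomomorphism = record { cong = *ₗ-congʳ }
        ; homo = λ a b → *ₗ-distribʳ u a b }
      ; ε-homo = *ₗ-zeroˡ u } a

    -ᴹ‿distribˡ-*ₗ : ∀ c u → -ᴹ (c *ₗ u) ≈ᴹ (- c) *ₗ u
    -ᴹ‿distribˡ-*ₗ c u = ≈ᴹ-sym (inverseˡ-uniqueᴹ _ _ (begin
      (- c) *ₗ u +ᴹ c *ₗ u ≈⟨ *ₗ-distribʳ u (- c) c ⟨
      (- c + c) *ₗ u       ≈⟨ *ₗ-congʳ (-‿inverseˡ c) ⟩
      0# *ₗ u              ≈⟨ *ₗ-zeroˡ u ⟩
      0ᴹ                   ∎))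

    -ᴹ‿distribʳ-*ₗ : ∀ c u → -ᴹ (c *ₗ u) ≈ᴹ c *ₗ (-ᴹ u)
    -ᴹ‿distribʳ-*ₗ c u = ≈ᴹ-sym (inverseˡ-uniqueᴹ _ _ (begin
      c *ₗ (-ᴹ u) +ᴹ c *ₗ u ≈⟨ *ₗ-distribˡ c (-ᴹ u) u ⟨
      c *ₗ (-ᴹ u +ᴹ u)      ≈⟨ *ₗ-congˡ (-ᴹ‿inverseˡ u) ⟩
      c *ₗ 0ᴹ               ≈⟨ *ₗ-zeroʳ c ⟩
      0ᴹ                    ∎))

    ·-identityˡ : ∀ {n} (u : Vector Carrierᴹ n) i → (δ · u) i ≈ᴹ u i
    ·-identityˡ {suc n} u zero = begin
      1# *ₗ u zero +ᴹ ∑[ j < n ] (0# *ₗ u (suc j))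
        ≈⟨ +ᴹ-cong (*ₗ-identityˡ (u zero)) (sum-zero _ (λ j → *ₗ-zeroˡ (u (suc j)))) ⟩
      u zero +ᴹ 0ᴹ
        ≈⟨ +ᴹ-identityʳ (u zero) ⟩
      u zero ∎
    ·-identityˡ {suc n} u (suc i) = begin
      0# *ₗ u zero +ᴹ (δ · tail u) i ≈⟨ +ᴹ-cong (*ₗ-zeroˡ (u zero)) (·-identityˡ (tail u) i) ⟩
      0ᴹ +ᴹ u (suc i)                ≈⟨ +ᴹ-identityˡ (u (suc i)) ⟩
      u (suc i)                      ∎

    ·-assoc : ∀ {n k l} (A : Matrix n k) (B : Matrix k l) u i → (A · B · u) i ≈ᴹ ((A ⊗ B) · u) i
    ·-assoc {k = k} {l} A B u i = begin
      ∑[ j < k ] (A i j *ₗ ∑[ q < l ] (B j q *ₗ u q))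
        ≈⟨ sum-cong-≋ (λ j → *ₗ-distribˡ-sum (A i j) (λ q → B j q *ₗ u q)) ⟩
      ∑[ j < k ] ∑[ q < l ] (A i j *ₗ B j q *ₗ u q)
        ≈⟨ sum-cong-≋ (λ j → sum-cong-≋ (λ q → ≈ᴹ-sym (*ₗ-assoc (A i j) (B j q) (u q)))) ⟩
      ∑[ j < k ] ∑[ q < l ] ((A i j * B j q) *ₗ u q)
        ≈⟨ ∑-comm (λ j q → (A i j * B j q) *ₗ u q) ⟩
      ∑[ q < l ] ∑[ j < k ] ((A i j * B j q) *ₗ u q)
        ≈⟨ sum-cong-≋ (λ q → ≈ᴹ-sym (*ₗ-distribʳ-sum (λ j → A i j * B j q) (u q))) ⟩
      ∑[ q < l ] ((A ⊗ B) i q *ₗ u q) ∎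

    ·-distribˡ-minus : ∀ {n k} (A : Matrix n k) u v i →
                       (A · (λ j → u j +ᴹ -ᴹ v j)) i ≈ᴹ (A · u) i +ᴹ -ᴹ (A · v) i
    ·-distribˡ-minus {k = k} A u v i = begin
      ∑[ j < k ] (A i j *ₗ (u j +ᴹ -ᴹ v j))
        ≈⟨ sum-cong-≋ (λ j → ≈ᴹ-trans (*ₗ-distribˡ (A i j) (u j) (-ᴹ v j))
                                       (+ᴹ-congˡ (≈ᴹ-sym (-ᴹ‿distribʳ-*ₗ (A i j) (v j))))) ⟩
      ∑[ j < k ] (A i j *ₗ u j +ᴹ -ᴹ (A i j *ₗ v j))
        ≈⟨ ∑-distrib-∙⁻¹ (λ j → A i j *ₗ u j) (λ j → A i j *ₗ v j) ⟩
      (A · u) i +ᴹ -ᴹ (A · v) i ∎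

    ·-distribʳ-minus : ∀ {n k} (A B : Matrix n k) u i →
                       ((λ i j → A i j - B i j) · u) i ≈ᴹ (A · u) i +ᴹ -ᴹ (B · u) i
    ·-distribʳ-minus {k = k} A B u i = begin
      ∑[ j < k ] ((A i j - B i j) *ₗ u j)
        ≈⟨ sum-cong-≋ (λ j → ≈ᴹ-trans (*ₗ-distribʳ (u j) (A i j) (- B i j))
                                       (+ᴹ-congˡ (≈ᴹ-sym (-ᴹ‿distribˡ-*ₗ (B i j) (u j))))) ⟩
      ∑[ j < k ] (A i j *ₗ u j +ᴹ -ᴹ (B i j *ₗ u j))
        ≈⟨ ∑-distrib-∙⁻¹ (λ j → A i j *ₗ u j) (λ j → B i j *ₗ u j) ⟩
      (A · u) i +ᴹ -ᴹ (B · u) i ∎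

    ·-zero-row : ∀ {n k} (A : Matrix n k) u i → (∀ j → A i j ≈ 0#) → (A · u) i ≈ᴹ 0ᴹ
    ·-zero-row A u i Aᵢ≈0 =
      sum-zero (λ j → A i j *ₗ u j) (λ j → ≈ᴹ-trans (*ₗ-congʳ (Aᵢ≈0 j)) (*ₗ-zeroˡ (u j)))

    ++-solution : ∀ {n₁ n₂ k} (A : Matrix n₁ k) (B : Matrix n₂ k) u →
                  Solution A u → Solution B u → Solution (A ++ B) u
    ++-solution {n₁} A B u Au≈0 Bu≈0 i with splitAt n₁ i
    ... | inj₁ i₁ = Au≈0 i₁
    ... | inj₂ i₂ = Bu≈0 i₂

    ++-solution⁻¹ : ∀ {n₁ n₂ k} (A : Matrix n₁ k) (B : Matrix n₂ k) u →
                    Solution (A ++ B) u → Solution A u × Solution B u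
    ++-solution⁻¹ {n₁} {n₂} A B u ABu≈0 =
        (λ i → ≡.subst (λ row → sum (λ j → row j *ₗ u j) ≈ᴹ 0ᴹ) (lookup-++ˡ A B i) (ABu≈0 (i ↑ˡ n₂)))
      , (λ i → ≡.subst (λ row → sum (λ j → row j *ₗ u j) ≈ᴹ 0ᴹ) (lookup-++ʳ A B i) (ABu≈0 (n₁ ↑ʳ i)))

    sumₗ≡sum : ∀ k (u : Vector Carrierᴹ k) → sumₗ M k u ≡ sum u
    sumₗ≡sum zero    u = ≡.refl
    sumₗ≡sum (suc k) u = ≡.cong (u zero +ᴹ_) (sumₗ≡sum k (tail u))

  module _ {m ℓm} (Q : RightModule R m ℓm) where
    open RightModule Q
    open AbelianGroupSum +ᴹ-abelianGroup using (sum-syntax)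
    open import Data.Vec.Functional.Relation.Binary.Equality.Setoid ≈ᴹ-setoid using (_≋_; ≋-isEquivalence)

    power : ℕ → RightModule R m ℓm
    power n = record
      { Carrierᴹ = Vector Carrierᴹ n
      ; _≈ᴹ_ = _≋_
      ; _+ᴹ_ = zipWith _+ᴹ_
      ; _*ᵣ_ = λ u c i → u i *ᵣ c
      ; 0ᴹ = replicate n 0ᴹ
      ; -ᴹ_ = map -ᴹ_
      ; isRightModule = record
        { isRightSemimodule = record
          { +ᴹ-isCommutativeMonoid = record
            { isMonoid = record
              { isSemigroup = record
                { isMagma = record
                  { isEquivalence = ≋-isEquivalence n
                  ; ∙-cong = λ u≋v w≋x i → +ᴹ-cong (u≋v i) (w≋x i) }
                ; assoc = λ u v w i → +ᴹ-assoc (u i) (v i) (w i) }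
              ; identity = (λ u i → +ᴹ-identityˡ (u i)) , (λ u i → +ᴹ-identityʳ (u i)) }
            ; comm = λ u v i → +ᴹ-comm (u i) (v i) }
          ; isPrerightSemimodule = record
            { *ᵣ-cong = λ u≋v c≈d i → *ᵣ-cong (u≋v i) c≈d
            ; *ᵣ-zeroʳ = λ u i → *ᵣ-zeroʳ (u i)
            ; *ᵣ-distribˡ = λ u c d i → *ᵣ-distribˡ (u i) c d
            ; *ᵣ-identityʳ = λ u i → *ᵣ-identityʳ (u i)
            ; *ᵣ-assoc = λ u c d i → *ᵣ-assoc (u i) c d
            ; *ᵣ-zeroˡ = λ c i → *ᵣ-zeroˡ c
            ; *ᵣ-distribʳ = λ c u v i → *ᵣ-distribʳ c (u i) (v i) } }
        ; -ᴹ‿cong = λ u≋v i → -ᴹ‿cong (u≋v i)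
        ; -ᴹ‿inverse = (λ u i → -ᴹ‿inverseˡ (u i)) , (λ u i → -ᴹ‿inverseʳ (u i)) } }

    power-sum-lookup : ∀ {n k} (F : Vector (Vector Carrierᴹ n) k) i →
                       MonoidSum.sum (RightModule.+ᴹ-monoid (power n)) F i ≈ᴹ ∑[ j < k ] F j i
    power-sum-lookup F i = sum-homo (RightModule.+ᴹ-monoid (power _)) +ᴹ-monoid record
      { isMagmaHomomorphism = record
        { isRelHomomorphism = record { cong = λ u≋v → u≋v i }
        ; homo = λ _ _ → ≈ᴹ-refl }
      ; ε-homo = ≈ᴹ-refl } F

  free : ℕ → RightModule R r ℓr
  free = power rightModule

  basis : ∀ {k} → Fin k → Vector Carrier k
  basis m l = δ l m

  module RightLinear {m ℓm} (Q : RightModule R m ℓm) where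
    open RightModule Q
    open AbelianGroupSum +ᴹ-abelianGroup
    open import Algebra.Module.Properties.RightModule Q using (inverseˡ-uniqueᴹ)
    open import Relation.Binary.Reasoning.Setoid ≈ᴹ-setoid

    sumᵣ≡sum : ∀ k (u : Vector Carrierᴹ k) → sumᵣ Q k u ≡ sum u
    sumᵣ≡sum zero    u = ≡.refl
    sumᵣ≡sum (suc k) u = ≡.cong (u zero +ᴹ_) (sumᵣ≡sum k (tail u))

    linearCombination : ∀ {n} → Vector Carrierᴹ n → Vector Carrier n → Carrierᴹ
    linearCombination {n} p v = ∑[ i < n ] (p i *ᵣ v i)

    -ᴹ‿distribʳ-*ᵣ : ∀ u c → -ᴹ (u *ᵣ c) ≈ᴹ u *ᵣ (- c)
    -ᴹ‿distribʳ-*ᵣ u c = ≈ᴹ-sym (inverseˡ-uniqueᴹ _ _ (begin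
      u *ᵣ (- c) +ᴹ u *ᵣ c ≈⟨ *ᵣ-distribˡ u (- c) c ⟨
      u *ᵣ (- c + c)       ≈⟨ *ᵣ-congˡ (-‿inverseˡ c) ⟩
      u *ᵣ 0#              ≈⟨ *ᵣ-zeroʳ u ⟩
      0ᴹ                   ∎))

    *ᵣ-distribʳ-sum : ∀ {n} (u : Vector Carrierᴹ n) c → sum u *ᵣ c ≈ᴹ ∑[ i < n ] (u i *ᵣ c)
    *ᵣ-distribʳ-sum u c = sum-homo +ᴹ-monoid +ᴹ-monoid record
      { isMagmaHomomorphism = record
        { isRelHomomorphism = record { cong = *ᵣ-congʳ }
        ; homo = *ᵣ-distribʳ c }
      ; ε-homo = *ᵣ-zeroˡ c } u

    linearCombination-isHom : ∀ {n} (p : Vector Carrierᴹ n) → IsHom (free n) Q (linearCombination p)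
    linearCombination-isHom {n} p = record
      { +ᴹ-isGroupHomomorphism = record
        { isMonoidHomomorphism = record
          { isMagmaHomomorphism = record
            { isRelHomomorphism = record { cong = λ v≋w → sum-cong-≋ (λ i → *ᵣ-congˡ (v≋w i)) }
            ; homo = λ v w → ≈ᴹ-trans (sum-cong-≋ (λ i → *ᵣ-distribˡ (p i) (v i) (w i)))
                                       (∑-distrib-+ (λ i → p i *ᵣ v i) (λ i → p i *ᵣ w i)) }
          ; ε-homo = sum-zero (λ i → p i *ᵣ 0#) (λ i → *ᵣ-zeroʳ (p i)) }
        ; ⁻¹-homo = λ v → ≈ᴹ-trans (sum-cong-≋ (λ i → ≈ᴹ-sym (-ᴹ‿distribʳ-*ᵣ (p i) (v i))))
                                    (sum-⁻¹ (λ i → p i *ᵣ v i)) }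
      ; *ᵣ-homo = λ c v → begin
          ∑[ i < n ] (p i *ᵣ (v i * c)) ≈⟨ sum-cong-≋ (λ i → *ᵣ-assoc (p i) (v i) c) ⟨
          ∑[ i < n ] (p i *ᵣ v i *ᵣ c)  ≈⟨ *ᵣ-distribʳ-sum (λ i → p i *ᵣ v i) c ⟨
          linearCombination p v *ᵣ c    ∎ }

  module _ {a ℓa b ℓb} (P : RightModule R a ℓa) (Q : RightModule R b ℓb)
           {f : RightModule.Carrierᴹ P → RightModule.Carrierᴹ Q} (f-hom : IsHom P Q f) where
    open RightModule Q
    open RightModuleMorphisms.IsRightModuleHomomorphism f-hom
    open AbelianGroupSum +ᴹ-abelianGroup
    private
      module P where
        open RightModule P public
        open RightLinear P public
      module Q = RightLinear Q

    hom-linearCombination : ∀ {n} (p : Vector P.Carrierᴹ n) v →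
                            f (P.linearCombination p v) ≈ᴹ Q.linearCombination (map f p) v
    hom-linearCombination {n} p v = ≈ᴹ-trans
      (sum-homo P.+ᴹ-monoid +ᴹ-monoid +ᴹ-isMonoidHomomorphism (λ i → p i P.*ᵣ v i))
      (sum-cong-≋ (λ i → *ᵣ-homo (v i) (p i)))

  module Rᵏ = LeftAction leftModule
  module Free {k} = RightLinear (free k)

  linearCombination-basis : ∀ {k} (v : Vector Carrier k) l → Free.linearCombination basis v l ≈ v l
  linearCombination-basis v l = trans (power-sum-lookup rightModule (λ m l → δ l m * v m) l)
                                     (Rᵏ.·-identityˡ v l)

  hom-basis : ∀ {m ℓm k} (Q : RightModule R m ℓm) {φ : Vector Carrier k → RightModule.Carrierᴹ Q} →
              IsHom (free k) Q φ →
              ∀ v → RightModule._≈ᴹ_ Q (φ v) (RightLinear.linearCombination Q (map φ (basis {k})) v)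
  hom-basis {k = k} Q φ-hom v = RightModule.≈ᴹ-trans Q
    (⟦⟧-cong (λ l → sym (linearCombination-basis v l)))
    (hom-linearCombination (free k) Q φ-hom basis v)
    where open RightModuleMorphisms.IsRightModuleHomomorphism φ-hom

  free-projective : ∀ n → Projective (free n)
  free-projective n A B g g-hom g-surjective f f-hom =
    linearCombination p , linearCombination-isHom p , λ v → begin
      g (linearCombination p v)              ≈⟨ hom-linearCombination A B g-hom p v ⟩
      B.linearCombination (map g p) v        ≈⟨ B.sum-cong-≋ (λ i → B.*ᵣ-congʳ (g∘p≈f∘basis i)) ⟩
      B.linearCombination (map f basis) v    ≈⟨ hom-basis B f-hom v ⟨
      f v                                    ∎
    where
    module B where
      open RightModule B public
      open RightLinear B public
      open AbelianGroupSum +ᴹ-abelianGroup public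
    open RightLinear A using (linearCombination; linearCombination-isHom)
    open import Relation.Binary.Reasoning.Setoid B.≈ᴹ-setoid
    p : Vector (RightModule.Carrierᴹ A) n
    p i = proj₁ (g-surjective (f (basis i)))
    g∘p≈f∘basis : ∀ i → g (p i) B.≈ᴹ f (basis i)
    g∘p≈f∘basis i = proj₂ (g-surjective (f (basis i))) (RightModule.≈ᴹ-refl A)

  module _ {a ℓa b ℓb} (P : RightModule R a ℓa) (Q : RightModule R b ℓb)
           {f : RightModule.Carrierᴹ P → RightModule.Carrierᴹ Q} (f-hom : IsHom P Q f) where
    private
      module P = RightModule P
    open RightModule Q
    open RightModuleMorphisms.IsRightModuleHomomorphism f-hom

    image : Submodule Q (a ⊔ ℓb)
    image = record
      { mem = λ y → Σ P.Carrierᴹ λ x → f x ≈ᴹ y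
      ; mem-resp = λ { y≈z (x , fx≈y) → x , ≈ᴹ-trans fx≈y y≈z }
      ; mem-0 = P.0ᴹ , 0ᴹ-homo
      ; mem-+ = λ { (x , fx≈y) (x′ , fx′≈y′) → x P.+ᴹ x′ , ≈ᴹ-trans (+ᴹ-homo x x′) (+ᴹ-cong fx≈y fx′≈y′) }
      ; mem-- = λ { (x , fx≈y) → P.-ᴹ x , ≈ᴹ-trans (-ᴹ-homo x) (-ᴹ‿cong fx≈y) }
      ; mem-* = λ { c (x , fx≈y) → x P.*ᵣ c , ≈ᴹ-trans (*ᵣ-homo c x) (*ᵣ-congʳ fx≈y) }
      }

    private
      module Image = RightModule (toRightModule image)

    corestriction : P.Carrierᴹ → Image.Carrierᴹ
    corestriction x = f x , x , ≈ᴹ-refl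

    corestriction-isHom : IsHom P (toRightModule image) corestriction
    corestriction-isHom = record
      { +ᴹ-isGroupHomomorphism = record
        { isMonoidHomomorphism = record
          { isMagmaHomomorphism = record
            { isRelHomomorphism = record { cong = ⟦⟧-cong }
            ; homo = +ᴹ-homo }
          ; ε-homo = 0ᴹ-homo }
        ; ⁻¹-homo = -ᴹ-homo }
      ; *ᵣ-homo = *ᵣ-homo }

    corestriction-surjective : Surjective P._≈ᴹ_ Image._≈ᴹ_ corestriction
    corestriction-surjective (y , x , fx≈y) = x , λ z≈x → ≈ᴹ-trans (⟦⟧-cong z≈x) fx≈y

  image-finitelyGenerated : ∀ {m ℓm k} (Q : RightModule R m ℓm)
                            {φ : Vector Carrier k → RightModule.Carrierᴹ Q} (φ-hom : IsHom (free k) Q φ) →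
                            FinitelyGenerated (image (free k) Q φ-hom)
  image-finitelyGenerated {k = k} Q {φ} φ-hom =
    k , map φ basis , (λ i → basis i , ≈ᴹ-refl) , λ { y (v , φv≈y) → v , (begin
      y                                    ≈⟨ φv≈y ⟨
      φ v                                  ≈⟨ hom-basis Q φ-hom v ⟩
      Q.linearCombination (map φ basis) v  ≡⟨ Q.sumᵣ≡sum k (λ i → φ (basis i) *ᵣ v i) ⟨
      sumᵣ Q k (λ i → φ (basis i) *ᵣ v i)  ∎) }
    where
    open RightModule Q
    module Q = RightLinear Q
    open import Relation.Binary.Reasoning.Setoid ≈ᴹ-setoid

  matrixOf : ∀ {n k} → (Vector Carrier k → Vector Carrier n) → Matrix n k
  matrixOf φ l m = φ (basis m) l

  matrixOf-· : ∀ {n k} {φ : Vector Carrier k → Vector Carrier n} →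
               IsHom (free k) (free n) φ → ∀ w l → (matrixOf φ Rᵏ.· w) l ≈ φ w l
  matrixOf-· {n} {φ = φ} φ-hom w l = begin
    (matrixOf φ Rᵏ.· w) l
      ≈⟨ power-sum-lookup rightModule (λ m l → φ (basis m) l * w m) l ⟨
    Free.linearCombination (map φ basis) w l
      ≈⟨ hom-basis (free n) φ-hom w l ⟨
    φ w l ∎
    where open import Relation.Binary.Reasoning.Setoid setoid

  linearMap : ∀ {n k} → Matrix n k → Vector Carrier k → Vector Carrier n
  linearMap A = Free.linearCombination (λ j i → A i j)

  linearMap-isHom : ∀ {n k} (A : Matrix n k) → IsHom (free k) (free n) (linearMap A)
  linearMap-isHom A = Free.linearCombination-isHom (λ j i → A i j)

  linearMap-· : ∀ {n k} (A : Matrix n k) v i → linearMap A v i ≈ (A Rᵏ.· v) i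
  linearMap-· A v i = power-sum-lookup rightModule (λ j i → A i j * v j) i

  record KernelProjection {n k} (A : Matrix n k) : Set (r ⊔ ℓr) where
    field
      E               : Matrix k k
      annihilated     : ∀ i m → (A ⊗ E) i m ≈ 0#
      fixes-solutions : ∀ w → Rᵏ.Solution A w → ∀ l → (E Rᵏ.· w) l ≈ w l

    idempotent : ∀ l m → (E ⊗ E) l m ≈ E l m
    idempotent l m = fixes-solutions (λ l → E l m) (λ i → annihilated i m) l

    stacked-solution-trivial : ∀ w → Rᵏ.Solution (A ++ E) w → ∀ l → w l ≈ 0#
    stacked-solution-trivial w AEw≈0 l with Rᵏ.++-solution⁻¹ A E w AEw≈0
    ... | Aw≈0 , Ew≈0 = trans (sym (fixes-solutions w Aw≈0 l)) (Ew≈0 l)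

  -- E is the matrix of id - s ∘ A for a section s of A onto its image; the section exists because
  -- the image is a finitely generated submodule of the projective module Rⁿ, hence projective.
  kernelProjection : RightSemihereditary R → ∀ {n k} (A : Matrix n k) → KernelProjection A
  kernelProjection semihereditary {n} {k} A = record
    { E               = E
    ; annihilated     = annihilated
    ; fixes-solutions = fixes-solutions
    }
    where
    open import Relation.Binary.Reasoning.Setoid setoid
    open import Algebra.Properties.Ring R using (-0#≈0#)

    S : Submodule (free n) (r ⊔ ℓr)
    S = image (free k) (free n) (linearMap-isHom A)

    module S = RightModule (toRightModule S)

    cs : Vector Carrier k → S.Carrierᴹ
    cs = corestriction (free k) (free n) (linearMap-isHom A)

    cs-isHom : IsHom (free k) (toRightModule S) cs
    cs-isHom = corestriction-isHom (free k) (free n) (linearMap-isHom A)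

    section : Σ (S.Carrierᴹ → Vector Carrier k) λ s →
                IsHom (toRightModule S) (free k) s × (∀ y → cs (s y) S.≈ᴹ y)
    section = semihereditary (free n) (free-projective n) S
                (image-finitelyGenerated (free n) (linearMap-isHom A))
                (free k) (toRightModule S) cs cs-isHom
                (corestriction-surjective (free k) (free n) (linearMap-isHom A))
                (λ y → y) (Id.isRightModuleHomomorphism S.rawRightModule (λ {y} → S.≈ᴹ-refl {y}))

    s : S.Carrierᴹ → Vector Carrier k
    s = proj₁ section

    s-isHom : IsHom (toRightModule S) (free k) s
    s-isHom = proj₁ (proj₂ section)

    π : Vector Carrier k → Vector Carrier k
    π w = s (cs w)

    π-isHom : IsHom (free k) (free k) π
    π-isHom = Comp.isRightModuleHomomorphism (RightModule.≈ᴹ-trans (free k)) cs-isHom s-isHom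

    E : Matrix k k
    E l m = δ l m - matrixOf π l m

    A·π : ∀ v i → (A Rᵏ.· π v) i ≈ (A Rᵏ.· v) i
    A·π v i = begin
      (A Rᵏ.· π v) i     ≈⟨ linearMap-· A (π v) i ⟨
      linearMap A (π v) i ≈⟨ proj₂ (proj₂ section) (cs v) i ⟩
      linearMap A v i     ≈⟨ linearMap-· A v i ⟩
      (A Rᵏ.· v) i       ∎

    π-solution : ∀ w → Rᵏ.Solution A w → ∀ l → π w l ≈ 0#
    π-solution w Aw≈0 = RightModule.≈ᴹ-trans (free k)
      (⟦⟧-cong {cs w} {S.0ᴹ} (λ i → trans (linearMap-· A w i) (Aw≈0 i)))
      0ᴹ-homo
      where open RightModuleMorphisms.IsRightModuleHomomorphism s-isHom

    annihilated : ∀ i m → (A ⊗ E) i m ≈ 0#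
    annihilated i m = begin
      (A Rᵏ.· (λ l → basis m l - π (basis m) l)) i ≈⟨ Rᵏ.·-distribˡ-minus A (basis m) (π (basis m)) i ⟩
      (A Rᵏ.· basis m) i - (A Rᵏ.· π (basis m)) i ≈⟨ +-congˡ (-‿cong (A·π (basis m) i)) ⟩
      (A Rᵏ.· basis m) i - (A Rᵏ.· basis m) i     ≈⟨ -‿inverseʳ _ ⟩
      0#                                           ∎

    fixes-solutions : ∀ w → Rᵏ.Solution A w → ∀ l → (E Rᵏ.· w) l ≈ w l
    fixes-solutions w Aw≈0 l = begin
      (E Rᵏ.· w) l
        ≈⟨ Rᵏ.·-distribʳ-minus δ (matrixOf π) w l ⟩
      (δ Rᵏ.· w) l - (matrixOf π Rᵏ.· w) l
        ≈⟨ +-cong (Rᵏ.·-identityˡ w l) (-‿cong (matrixOf-· π-isHom w l)) ⟩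
      w l - π w l
        ≈⟨ +-congˡ (trans (-‿cong (π-solution w Aw≈0 l)) -0#≈0#) ⟩
      w l + 0#
        ≈⟨ +-identityʳ (w l) ⟩
      w l ∎

  module _ {m ℓm} (M : LeftModule R m ℓm) where
    open LeftModule M
    open LeftAction M

    module _ {n k} {A : Matrix n k} (P : KernelProjection A) where
      open KernelProjection P
      open import Relation.Binary.Reasoning.Setoid ≈ᴹ-setoid
      open import Algebra.Properties.Group +ᴹ-group using (ε⁻¹≈ε)

      complement : Vector Carrierᴹ k → Vector Carrierᴹ k
      complement u j = u j +ᴹ -ᴹ (E · u) j

      complementᴬ : ∀ u → Solution A u → Solution A (complement u)
      complementᴬ u Au≈0 i = begin
        (A · complement u) i          ≈⟨ ·-distribˡ-minus A u (E · u) i ⟩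
        (A · u) i +ᴹ -ᴹ (A · E · u) i   ≈⟨ +ᴹ-cong (Au≈0 i) (-ᴹ‿cong (≈ᴹ-trans (·-assoc A E u i)
                                             (·-zero-row (A ⊗ E) u i (annihilated i)))) ⟩
        0ᴹ +ᴹ -ᴹ 0ᴹ                     ≈⟨ +ᴹ-identityˡ _ ⟩
        -ᴹ 0ᴹ                           ≈⟨ ε⁻¹≈ε ⟩
        0ᴹ                              ∎

      complementᴱ : ∀ u → Solution E (complement u)
      complementᴱ u l = begin
        (E · complement u) l          ≈⟨ ·-distribˡ-minus E u (E · u) l ⟩
        (E · u) l +ᴹ -ᴹ (E · E · u) l   ≈⟨ +ᴹ-congˡ (-ᴹ‿cong (≈ᴹ-trans (·-assoc E E u l)
                                                                    (·-congˡ idempotent u l))) ⟩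
        (E · u) l +ᴹ -ᴹ (E · u) l       ≈⟨ -ᴹ‿inverseʳ _ ⟩
        0ᴹ                              ∎

      complement-solution : ∀ u → Solution A u → Solution (A ++ E) (complement u)
      complement-solution u Au≈0 = ++-solution A E (complement u) (complementᴬ u Au≈0) (complementᴱ u)

      complement-unchanged : ∀ u t → (∀ m → E t m ≈ 0#) → complement u t ≈ᴹ u t
      complement-unchanged u t Eₜ≈0 = begin
        u t +ᴹ -ᴹ (E · u) t   ≈⟨ +ᴹ-congˡ (-ᴹ‿cong (·-zero-row E u t Eₜ≈0)) ⟩
        u t +ᴹ -ᴹ 0ᴹ          ≈⟨ +ᴹ-congˡ ε⁻¹≈ε ⟩
        u t +ᴹ 0ᴹ             ≈⟨ +ᴹ-identityʳ (u t) ⟩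
        u t                   ∎

module PPFormulas {r ℓr} (R : Ring r ℓr) where
  open Ring R hiding (zero)
  open LinearAlgebra R
  open import Algebra.Module.Construct.TensorUnit using (leftModule)

  matrix : (ψ : PPFormula R) → Matrix (PPFormula.eqs ψ) (suc (PPFormula.vars ψ))
  matrix ψ i = coeffX i ∷ coeffY i
    where open PPFormula ψ

  -- The formula ∃ w. z = wₜ ∧ B w = 0: its first equation is 1 · z - wₜ = 0, the others 0 · z + B w = 0.
  coordinate : ∀ {n k} → Matrix n k → Fin k → PPFormula R
  coordinate {n} {k} B t = record
    { eqs    = suc n
    ; vars   = k
    ; coeffX = 1# ∷ replicate n 0#
    ; coeffY = (λ j → - δ t j) ∷ B
    }

  module _ {m ℓm} (M : LeftModule R m ℓm) where
    open LeftModule M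
    open LeftAction M

    holds⇒solution : ∀ ψ {x y} → Holds M ψ x y → Solution (matrix ψ) (x ∷ y)
    holds⇒solution ψ {x} {y} ψ[x,y] i = ≈ᴹ-trans
      (+ᴹ-congˡ (≈ᴹ-reflexive (≡.sym (sumₗ≡sum vars (λ j → coeffY i j *ₗ y j))))) (ψ[x,y] i)
      where open PPFormula ψ

    solution⇒holds : ∀ ψ {x y} → Solution (matrix ψ) (x ∷ y) → Holds M ψ x y
    solution⇒holds ψ {x} {y} Au≈0 i = ≈ᴹ-trans
      (+ᴹ-congˡ (≈ᴹ-reflexive (sumₗ≡sum vars (λ j → coeffY i j *ₗ y j)))) (Au≈0 i)
      where open PPFormula ψ

    module _ {n k} (B : Matrix n k) (t : Fin k) {x : Carrierᴹ} (w : Vector Carrierᴹ k) where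
      open import Relation.Binary.Reasoning.Setoid ≈ᴹ-setoid
      open import Algebra.Properties.Group +ᴹ-group using (x∙y⁻¹≈ε⇒x≈y; x≈y⇒x∙y⁻¹≈ε)
      open AbelianGroupSum +ᴹ-abelianGroup using (sum-syntax; sum-cong-≋; sum-⁻¹)

      private
        first-row : (matrix (coordinate B t) · (x ∷ w)) zero ≈ᴹ x +ᴹ -ᴹ w t
        first-row = begin
          1# *ₗ x +ᴹ ∑[ j < k ] ((- δ t j) *ₗ w j)
            ≈⟨ +ᴹ-cong (*ₗ-identityˡ x) (sum-cong-≋ (λ j → ≈ᴹ-sym (-ᴹ‿distribˡ-*ₗ (δ t j) (w j)))) ⟩
          x +ᴹ ∑[ j < k ] (-ᴹ (δ t j *ₗ w j))
            ≈⟨ +ᴹ-congˡ (sum-⁻¹ (λ j → δ t j *ₗ w j)) ⟩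
          x +ᴹ -ᴹ (δ · w) t
            ≈⟨ +ᴹ-congˡ (-ᴹ‿cong (·-identityˡ w t)) ⟩
          x +ᴹ -ᴹ w t ∎

        other-row : ∀ i → (matrix (coordinate B t) · (x ∷ w)) (suc i) ≈ᴹ (B · w) i
        other-row i = ≈ᴹ-trans (+ᴹ-congʳ (*ₗ-zeroˡ x)) (+ᴹ-identityˡ _)

      coordinate-holds : x ≈ᴹ w t → Solution B w → Holds M (coordinate B t) x w
      coordinate-holds x≈wₜ Bw≈0 = solution⇒holds (coordinate B t) λ
        { zero    → ≈ᴹ-trans first-row (x≈y⇒x∙y⁻¹≈ε x≈wₜ)
        ; (suc i) → ≈ᴹ-trans (other-row i) (Bw≈0 i) }

      coordinate-holds⁻¹ : Holds M (coordinate B t) x w → x ≈ᴹ w t × Solution B w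
      coordinate-holds⁻¹ Φ[x,w] =
          x∙y⁻¹≈ε⇒x≈y x (w t) (≈ᴹ-trans (≈ᴹ-sym first-row) (solution zero))
        , λ i → ≈ᴹ-trans (≈ᴹ-sym (other-row i)) (solution (suc i))
        where
        solution : Solution (matrix (coordinate B t)) (x ∷ w)
        solution = holds⇒solution (coordinate B t) Φ[x,w]

  low⇒first-coordinate-zero : ∀ ψ → Low ψ → ∀ w → Rᵏ.Solution (matrix ψ) w → w zero ≈ 0#
  low⇒first-coordinate-zero ψ low w Aw≈0 = low (w zero) (tail w , solution⇒holds leftModule ψ Aw≈0)

  coordinate-low : ∀ {n k} (B : Matrix n k) t → (∀ w → Rᵏ.Solution B w → w t ≈ 0#) → Low (coordinate B t)
  coordinate-low B t only-trivial a (w , Φ[a,w]) with coordinate-holds⁻¹ leftModule B t w Φ[a,w]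
  ... | a≈wₜ , Bw≈0 = trans a≈wₜ (only-trivial w Bw≈0)

module _ {r ℓr} {R : Ring r ℓr} (semihereditary : RightSemihereditary R)
         {m ℓm} (M : LeftModule R m ℓm) where
  open Ring R using (_≈_; 0#)
  open LinearAlgebra R
  open PPFormulas R
  open LeftModule M
  open LeftAction M

  𝔰⊆𝔰𝔰 : ∀ x → 𝔰 M x → 𝔰In M (𝔰 M) x
  𝔰⊆𝔰𝔰 x x∈𝔰M@(ψ , ψ-low , y , ψ[x,y]) =
      x∈𝔰M , Φ zero , Φ-low zero , v
    , (λ t → Φ t , Φ-low t , v , coordinate-holds M B t v ≈ᴹ-refl Bv≈0)
    , coordinate-holds M B zero v (≈ᴹ-sym v₀≈x) Bv≈0
    where
    open PPFormula ψ using (eqs; vars)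

    A : Matrix eqs (suc vars)
    A = matrix ψ

    P : KernelProjection A
    P = kernelProjection semihereditary A
    open KernelProjection P

    B : Matrix (eqs ℕ.+ suc vars) (suc vars)
    B = A ++ E

    Φ : Fin (suc vars) → PPFormula R
    Φ = coordinate B

    v : Vector Carrierᴹ (suc vars)
    v = complement M P (x ∷ y)

    Φ-low : ∀ t → Low (Φ t)
    Φ-low t = coordinate-low B t λ w Bw≈0 → stacked-solution-trivial w Bw≈0 t

    Bv≈0 : Solution B v
    Bv≈0 = complement-solution M P (x ∷ y) (holds⇒solution M ψ ψ[x,y])

    first-row-zero : ∀ m → E zero m ≈ 0#
    first-row-zero m = low⇒first-coordinate-zero ψ ψ-low (λ l → E l m) (λ i → annihilated i m)

    v₀≈x : v zero ≈ᴹ x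
    v₀≈x = complement-unchanged M P (x ∷ y) zero first-row-zero

proposition3p7 : ∀ {r ℓr} (R : Ring r ℓr) → RightSemihereditary R →
    ∀ {m ℓm} (M : LeftModule R m ℓm) →
      ((∀ x → 𝔰In M (𝔰 M) x → 𝔰 M x) × (∀ x → 𝔰 M x → 𝔰In M (𝔰 M) x))
      × 𝔰-TorsionIn M (𝔰 M)
proposition3p7 R semihereditary M = ((λ _ → proj₁) , 𝔰⊆𝔰𝔰 semihereditary M) , 𝔰⊆𝔰𝔰 semihereditary M
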